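{- For every $n\in\mathbb{Z}$ and $w\in\mathfrak{h}$, \[ f_n(xw)=xf_n(w)+yf_{n-1}(xw),\qquad f_n(yw)=yf_n(w)-yf_{n-1}(xw). \]
   Context: Let $\mathfrak{h}=\mathbb{Q}\langle x,y\rangle$ and $z=x+y$. The harmonic product $*$ on $\mathfrak{h}$ is the bilinear map with $1*w=w*1=w$, $xw_1*w_2=w_1*xw_2=x(w_1*w_2)$ and $yw_1*yw_2=y(w_1*yw_2)+y(yw_1*w_2)+yx(w_1*w_2)$ for $w,w_1,w_2\in\mathfrak{h}$. Let $\varphi$ be the algebra automorphism of $\mathfrak{h}$ with $\varphi(x)=z$, $\varphi(y)=-y$ (an involution), and define the bilinear product $w_1\diamond w_2=\varphi(\varphi(w_1)*\varphi(w_2))$. For $n\in\mathbb{Z}$ and $w\in\mathfrak{h}$ define $f_n(w)=0$ if $n<0$, $f_0(w)=w$, and $f_n(w)=y^n\diamond w-(y^{n-1}\diamond w)y$ if $n\ge1$. -}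

module Defs where

open import Data.Bool using (Bool; true; false; if_then_else_)
open import Data.List using (List; []; _∷_; _++_; map; concatMap; replicate)
open import Data.List.Properties using (≡-dec)
open import Data.Product using (_×_; _,_)
open import Data.Nat using (ℕ; zero; suc)
open import Data.Integer using (ℤ; +_; -[1+_])
open import Data.Rational using (ℚ; 0ℚ; 1ℚ) renaming (_+_ to _+ℚ_; _*_ to _*ℚ_; -_ to -ℚ_)
open import Relation.Nullary using (Dec; yes; no)
open import Relation.Nullary.Decidable using (⌊_⌋)
open import Relation.Binary.PropositionalEquality using (_≡_; refl)

data Letter : Set where
  lx ly : Letter

_≟L_ : (a b : Letter) → Dec (a ≡ b)
lx ≟L lx = yes refl
ly ≟L ly = yes refl
lx ≟L ly = no (λ ())
ly ≟L lx = no (λ ())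

Word : Set
Word = List Letter

_≟W_ : (u v : Word) → Dec (u ≡ v)
_≟W_ = ≡-dec _≟L_

-- An element of 𝔥 = ℚ⟨x,y⟩, as a formal (unreduced) linear combination of words.
Poly : Set
Poly = List (ℚ × Word)

coeff : Word → Poly → ℚ
coeff u [] = 0ℚ
coeff u ((c , v) ∷ p) = (if ⌊ u ≟W v ⌋ then c else 0ℚ) +ℚ coeff u p

infix 4 _≈_
_≈_ : Poly → Poly → Set
p ≈ q = ∀ u → coeff u p ≡ coeff u q

infixl 6 _⊕_ _⊖_
_⊕_ : Poly → Poly → Poly
p ⊕ q = p ++ q

scale : ℚ → Poly → Poly
scale a = map (λ { (c , v) → (a *ℚ c , v) })

neg : Poly → Poly
neg = scale (-ℚ 1ℚ)

_⊖_ : Poly → Poly → Poly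
p ⊖ q = p ⊕ neg q

mono : Word → Poly
mono u = (1ℚ , u) ∷ []

_·_ : Poly → Poly → Poly
p · q = concatMap (λ { (a , u) → map (λ { (b , v) → (a *ℚ b , u ++ v) }) q }) p

x y z : Poly
x = mono (lx ∷ [])
y = mono (ly ∷ [])
z = x ⊕ y

lmul : Letter → Poly → Poly
lmul l = map (λ { (c , v) → (c , l ∷ v) })

harmW : Word → Word → Poly
harmW [] v = mono v
harmW (lx ∷ u) v = lmul lx (harmW u v)
harmW (ly ∷ u) [] = mono (ly ∷ u)
harmW (ly ∷ u) (lx ∷ v) = lmul lx (harmW (ly ∷ u) v)
harmW (ly ∷ u) (ly ∷ v) =
  lmul ly (harmW u (ly ∷ v)) ⊕ lmul ly (harmW (ly ∷ u) v) ⊕ lmul ly (lmul lx (harmW u v))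

_✶_ : Poly → Poly → Poly
p ✶ q = concatMap (λ { (a , u) → concatMap (λ { (b , v) → scale (a *ℚ b) (harmW u v) }) q }) p

φL : Letter → Poly
φL lx = z
φL ly = neg y

φW : Word → Poly
φW [] = mono []
φW (l ∷ u) = φL l · φW u

φ : Poly → Poly
φ = concatMap (λ { (a , u) → scale a (φW u) })

_◇_ : Poly → Poly → Poly
p ◇ q = φ (φ p ✶ φ q)

yPow : ℕ → Poly
yPow n = mono (replicate n ly)

f : ℤ → Poly → Poly
f -[1+ _ ] w = []
f (+ zero) w = w
f (+ suc m) w = (yPow (suc m) ◇ w) ⊖ ((yPow m ◇ w) · y)

-- Polynomials are compared through the linear forms extend g (g : Word → ℚ), which determine a
-- polynomial up to ≈; all operations involved are linear, so identities reduce to identities on words.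
-- Conjugating the harmonic product by φ (x ↦ x + y, y ↦ −y) turns its recursion into two rules for ◇:
--   p ◇ zw = z (p ◇ w)   and   yp ◇ yw = y (yp ◇ w) − y (p ◇ xw).
-- Setting y^n ◇ w = 0 for n < 0, one has f_n(w) = y^n ◇ w − (y^(n−1) ◇ w) y for every n ∈ ℤ. The second
-- rule then gives the formula for f_n(yw) directly, and the first gives f_n(zw) = z f_n(w), from which
-- the formula for f_n(xw) follows by subtraction.
module Submission where

open import Defs
open import Data.Bool using (true; false; if_then_else_)
open import Data.Empty using (⊥-elim)
open import Data.Fin using (Fin; #_)
open import Data.Integer using (ℤ; _-_; 1ℤ; +_; -[1+_])
open import Data.List using (List; []; _∷_; _++_; map; concatMap; deduplicate)
open import Data.List.Membership.Propositional using (_∈_)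
open import Data.List.Membership.Propositional.Properties using (∈-++⁺ˡ; ∈-++⁺ʳ; ∈-deduplicate⁺)
open import Data.List.Properties using (map-++; ++-identityʳ)
open import Data.List.Relation.Unary.All as All using (All; []; _∷_)
open import Data.List.Relation.Unary.AllPairs using (_∷_)
open import Data.List.Relation.Unary.Any using (here; there)
open import Data.List.Relation.Unary.Unique.Propositional using (Unique)
open import Data.List.Relation.Unary.Unique.DecPropositional.Properties _≟W_ using (deduplicate-!)
open import Data.Nat using (ℕ; zero; suc)
open import Data.Product using (_×_; _,_; proj₁; proj₂)
open import Data.Rational using (ℚ; 0ℚ; 1ℚ) renaming (_+_ to _+ℚ_; _*_ to _*ℚ_; -_ to -ℚ_)
import Data.Rational.Properties as ℚ
open import Algebra.Properties.Group ℚ.+-0-group using () renaming (∙-cancelʳ to +-cancelʳ)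
open import Data.Rational.Solver using (module +-*-Solver)
open +-*-Solver using (solve; _:=_; _:+_; _:*_; :-_; con; Polynomial; ⟦_⟧; ⟦_⟧↓; correct)
open import Data.Vec as V using (Vec; lookup; _∷_; [])
import Data.Vec.Properties as VP
open import Function using (_∘′_)
open import Level using (0ℓ)
open import Relation.Binary.Bundles using (Setoid)
open import Relation.Binary.PropositionalEquality
import Relation.Binary.Reasoning.Setoid as SetoidReasoning
open import Relation.Nullary using (¬_; yes; no)
open import Relation.Nullary.Decidable using (⌊_⌋)

-- Linear forms

δ : Word → Word → ℚ
δ u v = if ⌊ u ≟W v ⌋ then 1ℚ else 0ℚ

if-c-0≡c*if-1-0 : ∀ b c → (if b then c else 0ℚ) ≡ c *ℚ (if b then 1ℚ else 0ℚ)
if-c-0≡c*if-1-0 true c = sym (ℚ.*-identityʳ c)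
if-c-0≡c*if-1-0 false c = sym (ℚ.*-zeroʳ c)

sumTerms : (ℚ × Word → ℚ) → Poly → ℚ
sumTerms h [] = 0ℚ
sumTerms h (t ∷ p) = h t +ℚ sumTerms h p

extend : (Word → ℚ) → Poly → ℚ
extend g = sumTerms (λ (a , v) → a *ℚ g v)

coeff≡extend-δ : ∀ u p → coeff u p ≡ extend (δ u) p
coeff≡extend-δ u [] = refl
coeff≡extend-δ u ((c , v) ∷ p) = cong₂ _+ℚ_ (if-c-0≡c*if-1-0 ⌊ u ≟W v ⌋ c) (coeff≡extend-δ u p)

extend-cong : ∀ {g h} p → (∀ v → g v ≡ h v) → extend g p ≡ extend h p
extend-cong [] e = refl
extend-cong ((c , v) ∷ p) e = cong₂ (λ a b → c *ℚ a +ℚ b) (e v) (extend-cong p e)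

extend-++ : ∀ g p q → extend g (p ++ q) ≡ extend g p +ℚ extend g q
extend-++ g [] q = sym (ℚ.+-identityˡ _)
extend-++ g ((a , v) ∷ p) q rewrite extend-++ g p q = sym (ℚ.+-assoc (a *ℚ g v) (extend g p) (extend g q))

extend-scale : ∀ g a p → extend g (scale a p) ≡ a *ℚ extend g p
extend-scale g a [] = sym (ℚ.*-zeroʳ a)
extend-scale g a ((c , v) ∷ p) rewrite extend-scale g a p =
  solve 4 (λ a c gv s → (a :* c) :* gv :+ a :* s := a :* (c :* gv :+ s)) refl a c (g v) (extend g p)

extend-lmul : ∀ g l p → extend g (lmul l p) ≡ extend (λ v → g (l ∷ v)) p
extend-lmul g l [] = refl
extend-lmul g l ((c , v) ∷ p) = cong (c *ℚ g (l ∷ v) +ℚ_) (extend-lmul g l p)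

extend-mono : ∀ g v → extend g (mono v) ≡ g v
extend-mono g v = trans (ℚ.+-identityʳ _) (ℚ.*-identityˡ _)

extend-+ : ∀ g h p → extend (λ v → g v +ℚ h v) p ≡ extend g p +ℚ extend h p
extend-+ g h [] = sym (ℚ.+-identityˡ 0ℚ)
extend-+ g h ((c , v) ∷ p) rewrite extend-+ g h p =
  solve 5 (λ c a b s t → c :* (a :+ b) :+ (s :+ t) := (c :* a :+ s) :+ (c :* b :+ t))
    refl c (g v) (h v) (extend g p) (extend h p)

extend-* : ∀ k g p → extend (λ v → k *ℚ g v) p ≡ k *ℚ extend g p
extend-* k g [] = sym (ℚ.*-zeroʳ k)
extend-* k g ((c , v) ∷ p) rewrite extend-* k g p =
  solve 4 (λ k c a s → c :* (k :* a) :+ k :* s := k :* (c :* a :+ s)) refl k c (g v) (extend g p)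

extend-0 : ∀ p → extend (λ _ → 0ℚ) p ≡ 0ℚ
extend-0 [] = refl
extend-0 ((c , v) ∷ p) rewrite extend-0 p | ℚ.*-zeroʳ c = refl

-1*q≡-q : ∀ q → (-ℚ 1ℚ) *ℚ q ≡ -ℚ q
-1*q≡-q q = trans (sym (ℚ.neg-distribˡ-* 1ℚ q)) (cong -ℚ_ (ℚ.*-identityˡ q))

extend-neg : ∀ g p → extend g (neg p) ≡ -ℚ extend g p
extend-neg g p = trans (extend-scale g (-ℚ 1ℚ) p) (-1*q≡-q _)

extend-neg-pointwise : ∀ g p → extend (λ v → -ℚ g v) p ≡ -ℚ extend g p
extend-neg-pointwise g p =
  trans (extend-cong p (λ v → sym (-1*q≡-q (g v)))) (trans (extend-* (-ℚ 1ℚ) g p) (-1*q≡-q _))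

sumTerms-cong : ∀ {h k} p → (∀ t → h t ≡ k t) → sumTerms h p ≡ sumTerms k p
sumTerms-cong [] e = refl
sumTerms-cong (t ∷ p) e = cong₂ _+ℚ_ (e t) (sumTerms-cong p e)

sumTerms-scaled : ∀ a g q → sumTerms (λ (b , v) → (a *ℚ b) *ℚ g v) q ≡ a *ℚ extend g q
sumTerms-scaled a g [] = sym (ℚ.*-zeroʳ a)
sumTerms-scaled a g ((b , v) ∷ q) rewrite sumTerms-scaled a g q =
  solve 4 (λ a b h s → (a :* b) :* h :+ a :* s := a :* (b :* h :+ s)) refl a b (g v) (extend g q)

extend-concatMap : ∀ g F q → extend g (concatMap F q) ≡ sumTerms (λ t → extend g (F t)) q
extend-concatMap g F [] = refl
extend-concatMap g F (t ∷ q) =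
  trans (extend-++ g (F t) (concatMap F q)) (cong (extend g (F t) +ℚ_) (extend-concatMap g F q))

extend-map : ∀ g F q → extend g (map F q) ≡ sumTerms (λ t → proj₁ (F t) *ℚ g (proj₂ (F t))) q
extend-map g F [] = refl
extend-map g F (t ∷ q) = cong (proj₁ (F t) *ℚ g (proj₂ (F t)) +ℚ_) (extend-map g F q)

extend₂ : (Word → Word → ℚ) → Poly → Poly → ℚ
extend₂ h p q = extend (λ u → extend (h u) q) p

extend₂-cong : ∀ {h k} p q → (∀ u v → h u v ≡ k u v) → extend₂ h p q ≡ extend₂ k p q
extend₂-cong p q e = extend-cong p (λ u → extend-cong q (e u))

extend₂-+ : ∀ h k p q → extend₂ (λ u v → h u v +ℚ k u v) p q ≡ extend₂ h p q +ℚ extend₂ k p q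
extend₂-+ h k p q = trans (extend-cong p (λ u → extend-+ (h u) (k u) q)) (extend-+ _ _ p)

extend₂-lmulˡ : ∀ h l p q → extend₂ h (lmul l p) q ≡ extend₂ (λ u → h (l ∷ u)) p q
extend₂-lmulˡ h l p q = extend-lmul _ l p

extend₂-lmulʳ : ∀ h l p q → extend₂ h p (lmul l q) ≡ extend₂ (λ u v → h u (l ∷ v)) p q
extend₂-lmulʳ h l p q = extend-cong p (λ u → extend-lmul (h u) l q)

extend₂-swap : ∀ h p q → extend₂ h p q ≡ extend₂ (λ v u → h u v) q p
extend₂-swap h [] q = sym (extend-0 q)
extend₂-swap h ((a , u) ∷ p) q = begin
  a *ℚ extend (h u) q +ℚ extend₂ h p q
    ≡⟨ cong₂ _+ℚ_ (sym (extend-* a (h u) q)) (extend₂-swap h p q) ⟩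
  extend (λ v → a *ℚ h u v) q +ℚ extend₂ (λ v u → h u v) q p
    ≡⟨ extend-+ _ _ q ⟨
  extend₂ (λ v u → h u v) q ((a , u) ∷ p)
    ∎
  where open ≡-Reasoning

extend-· : ∀ g p q → extend g (p · q) ≡ extend₂ (λ u v → g (u ++ v)) p q
extend-· g p q =
  trans (extend-concatMap g _ p)
        (sumTerms-cong p λ (a , u) → trans (extend-map g _ q) (sumTerms-scaled a (λ v → g (u ++ v)) q))

extend-✶ : ∀ g p q → extend g (p ✶ q) ≡ extend₂ (λ u v → extend g (harmW u v)) p q
extend-✶ g p q =
  trans (extend-concatMap g _ p) (sumTerms-cong p λ (a , u) →
  trans (extend-concatMap g _ q) (trans (sumTerms-cong q (λ (b , v) → extend-scale g (a *ℚ b) (harmW u v)))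
        (sumTerms-scaled a (λ v → extend g (harmW u v)) q)))

extend-φ : ∀ g p → extend g (φ p) ≡ extend (λ v → extend g (φW v)) p
extend-φ g [] = refl
extend-φ g ((a , v) ∷ p) =
  trans (extend-++ g (scale a (φW v)) (φ p)) (cong₂ _+ℚ_ (extend-scale g a (φW v)) (extend-φ g p))

-- A record, so that the two polynomials can be inferred from a proof of p ≋ q.
infix 4 _≋_
record _≋_ (p q : Poly) : Set where
  constructor mk≋
  field coeff-≡ : p ≈ q
open _≋_

≋-by-extend : ∀ {p q} → (∀ g → extend g p ≡ extend g q) → p ≋ q
≋-by-extend {p} {q} e = mk≋ λ u → trans (coeff≡extend-δ u p) (trans (e (δ u)) (sym (coeff≡extend-δ u q)))

sumOver : (Word → ℚ) → List Word → ℚ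
sumOver h [] = 0ℚ
sumOver h (w ∷ ws) = h w +ℚ sumOver h ws

sumOver-cong : ∀ {g h} ws → (∀ v → g v ≡ h v) → sumOver g ws ≡ sumOver h ws
sumOver-cong [] e = refl
sumOver-cong (w ∷ ws) e = cong₂ _+ℚ_ (e w) (sumOver-cong ws e)

sumOver-+ : ∀ g h ws → sumOver (λ v → g v +ℚ h v) ws ≡ sumOver g ws +ℚ sumOver h ws
sumOver-+ g h [] = sym (ℚ.+-identityˡ 0ℚ)
sumOver-+ g h (w ∷ ws) rewrite sumOver-+ g h ws =
  solve 4 (λ a b s t → (a :+ b) :+ (s :+ t) := (a :+ s) :+ (b :+ t))
    refl (g w) (h w) (sumOver g ws) (sumOver h ws)

sumOver-0 : ∀ ws → sumOver (λ _ → 0ℚ) ws ≡ 0ℚ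
sumOver-0 [] = refl
sumOver-0 (w ∷ ws) rewrite sumOver-0 ws = refl

sumOver-monomial-∉ : ∀ (a : ℚ) (g : Word → ℚ) v ws → All (λ u → ¬ v ≡ u) ws →
  sumOver (λ u → (if ⌊ u ≟W v ⌋ then a else 0ℚ) *ℚ g u) ws ≡ 0ℚ
sumOver-monomial-∉ a g v [] [] = refl
sumOver-monomial-∉ a g v (w ∷ ws) (v≢w ∷ v∉ws) with w ≟W v
... | yes w≡v = ⊥-elim (v≢w (sym w≡v))
... | no _ = cong₂ _+ℚ_ (ℚ.*-zeroˡ (g w)) (sumOver-monomial-∉ a g v ws v∉ws)

sumOver-monomial-∈ : ∀ (a : ℚ) (g : Word → ℚ) v ws → Unique ws → v ∈ ws →
  sumOver (λ u → (if ⌊ u ≟W v ⌋ then a else 0ℚ) *ℚ g u) ws ≡ a *ℚ g v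
sumOver-monomial-∈ a g v (w ∷ ws) (w∉ws ∷ _) (here refl) with w ≟W w
... | no w≢w = ⊥-elim (w≢w refl)
... | yes _ = trans (cong (a *ℚ g w +ℚ_) (sumOver-monomial-∉ a g w ws w∉ws)) (ℚ.+-identityʳ _)
sumOver-monomial-∈ a g v (w ∷ ws) (w∉ws ∷ ws!) (there v∈ws) with w ≟W v
... | yes refl = ⊥-elim (All.lookup w∉ws v∈ws refl)
... | no _ = trans (cong₂ _+ℚ_ (ℚ.*-zeroˡ (g w)) (sumOver-monomial-∈ a g v ws ws! v∈ws)) (ℚ.+-identityˡ _)

words : Poly → List Word
words = map proj₂

extend≡sumOver-coeff : ∀ g p ws → Unique ws → (∀ {v} → v ∈ words p → v ∈ ws) →
  extend g p ≡ sumOver (λ u → coeff u p *ℚ g u) ws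
extend≡sumOver-coeff g [] ws _ _ = sym (trans (sumOver-cong ws (λ v → ℚ.*-zeroˡ (g v))) (sumOver-0 ws))
extend≡sumOver-coeff g ((a , v) ∷ p) ws ws! covers = begin
  a *ℚ g v +ℚ extend g p
    ≡⟨ cong₂ _+ℚ_ (sym (sumOver-monomial-∈ a g v ws ws! (covers (here refl))))
                  (extend≡sumOver-coeff g p ws ws! (covers ∘′ there)) ⟩
  sumOver monomial ws +ℚ sumOver (λ u → coeff u p *ℚ g u) ws
    ≡⟨ sym (sumOver-+ _ _ ws) ⟩
  sumOver (λ u → monomial u +ℚ coeff u p *ℚ g u) ws
    ≡⟨ sumOver-cong ws (λ u → sym (ℚ.*-distribʳ-+ (g u) (if ⌊ u ≟W v ⌋ then a else 0ℚ) (coeff u p))) ⟩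
  sumOver (λ u → coeff u ((a , v) ∷ p) *ℚ g u) ws
    ∎
  where
  open ≡-Reasoning
  monomial : Word → ℚ
  monomial u = (if ⌊ u ≟W v ⌋ then a else 0ℚ) *ℚ g u

-- Both sides are expanded over one duplicate-free list containing every word of p and of q.
extend-resp-≋ : ∀ g {p q} → p ≋ q → extend g p ≡ extend g q
extend-resp-≋ g {p} {q} (mk≋ p≈q) = begin
  extend g p
    ≡⟨ extend≡sumOver-coeff g p ws ws! (λ m → ∈-deduplicate⁺ _≟W_ (∈-++⁺ˡ m)) ⟩
  sumOver (λ u → coeff u p *ℚ g u) ws       ≡⟨ sumOver-cong ws (λ u → cong (_*ℚ g u) (p≈q u)) ⟩
  sumOver (λ u → coeff u q *ℚ g u) ws
    ≡⟨ extend≡sumOver-coeff g q ws ws! (λ m → ∈-deduplicate⁺ _≟W_ (∈-++⁺ʳ (words p) m)) ⟨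
  extend g q                                ∎
  where
  open ≡-Reasoning
  ws = deduplicate _≟W_ (words p ++ words q)
  ws! = deduplicate-! (words p ++ words q)

≋-setoid : Setoid 0ℓ 0ℓ
≋-setoid = record
  { Carrier = Poly
  ; _≈_ = _≋_
  ; isEquivalence = record
    { refl = mk≋ λ _ → refl
    ; sym = λ (mk≋ e) → mk≋ λ u → sym (e u)
    ; trans = λ (mk≋ e) (mk≋ e′) → mk≋ λ u → trans (e u) (e′ u)
    }
  }

open Setoid ≋-setoid using () renaming (refl to ≋-refl; sym to ≋-sym; trans to ≋-trans)

module ≋-Reasoning = SetoidReasoning ≋-setoid

≡⇒≋ : ∀ {p q} → p ≡ q → p ≋ q
≡⇒≋ refl = ≋-refl

⊕-identityʳ : ∀ p → p ⊕ [] ≋ p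
⊕-identityʳ p = ≡⇒≋ (++-identityʳ p)

-- Linear identities

-- Formal ℤ-linear combinations of n polynomials. An identity between two of them holds as soon as
-- the corresponding ℚ-polynomials have the same normal form, i.e. when the premise below is proved by
-- λ _ → refl.
infixl 6 _⊞_ _⊟_
data LinExpr (n : ℕ) : Set where
  var : Fin n → LinExpr n
  _⊞_ : LinExpr n → LinExpr n → LinExpr n
  ⊟_  : LinExpr n → LinExpr n

_⊟_ : ∀ {n} → LinExpr n → LinExpr n → LinExpr n
a ⊟ b = a ⊞ (⊟ b)

⟦_⟧ᴸ : ∀ {n} → LinExpr n → Vec Poly n → Poly
⟦ var i ⟧ᴸ ρ = lookup ρ i
⟦ a ⊞ b ⟧ᴸ ρ = ⟦ a ⟧ᴸ ρ ⊕ ⟦ b ⟧ᴸ ρ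
⟦ ⊟ a ⟧ᴸ ρ = neg (⟦ a ⟧ᴸ ρ)

toPolynomial : ∀ {n} → LinExpr n → Polynomial n
toPolynomial (var i) = Polynomial.var i
toPolynomial (a ⊞ b) = toPolynomial a :+ toPolynomial b
toPolynomial (⊟ a) = :- toPolynomial a

extend-⟦⟧ᴸ : ∀ {n} g (e : LinExpr n) ρ → extend g (⟦ e ⟧ᴸ ρ) ≡ ⟦ toPolynomial e ⟧ (V.map (extend g) ρ)
extend-⟦⟧ᴸ g (var i) ρ = sym (VP.lookup-map i (extend g) ρ)
extend-⟦⟧ᴸ g (a ⊞ b) ρ =
  trans (extend-++ g (⟦ a ⟧ᴸ ρ) (⟦ b ⟧ᴸ ρ)) (cong₂ _+ℚ_ (extend-⟦⟧ᴸ g a ρ) (extend-⟦⟧ᴸ g b ρ))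
extend-⟦⟧ᴸ g (⊟ a) ρ = trans (extend-neg g (⟦ a ⟧ᴸ ρ)) (cong -ℚ_ (extend-⟦⟧ᴸ g a ρ))

linear-identity : ∀ {n} (e₁ e₂ : LinExpr n) ρ →
  (∀ σ → ⟦ toPolynomial e₁ ⟧↓ σ ≡ ⟦ toPolynomial e₂ ⟧↓ σ) →
  ⟦ e₁ ⟧ᴸ ρ ≋ ⟦ e₂ ⟧ᴸ ρ
linear-identity e₁ e₂ ρ same = ≋-by-extend λ g → begin
  extend g (⟦ e₁ ⟧ᴸ ρ)                               ≡⟨ extend-⟦⟧ᴸ g e₁ ρ ⟩
  ⟦ toPolynomial e₁ ⟧ (V.map (extend g) ρ)           ≡⟨ correct (toPolynomial e₁) _ ⟨
  ⟦ toPolynomial e₁ ⟧↓ (V.map (extend g) ρ)          ≡⟨ same (V.map (extend g) ρ) ⟩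
  ⟦ toPolynomial e₂ ⟧↓ (V.map (extend g) ρ)          ≡⟨ correct (toPolynomial e₂) _ ⟩
  ⟦ toPolynomial e₂ ⟧ (V.map (extend g) ρ)           ≡⟨ extend-⟦⟧ᴸ g e₂ ρ ⟨
  extend g (⟦ e₂ ⟧ᴸ ρ)                               ∎
  where open ≡-Reasoning

linear-identity-using : ∀ {n} (e₁ e₂ h₁ h₂ : LinExpr n) ρ → ⟦ h₁ ⟧ᴸ ρ ≋ ⟦ h₂ ⟧ᴸ ρ →
  (∀ σ → ⟦ toPolynomial (e₁ ⊞ h₂) ⟧↓ σ ≡ ⟦ toPolynomial (e₂ ⊞ h₁) ⟧↓ σ) →
  ⟦ e₁ ⟧ᴸ ρ ≋ ⟦ e₂ ⟧ᴸ ρ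
linear-identity-using e₁ e₂ h₁ h₂ ρ h₁≋h₂ same = ≋-by-extend λ g →
  +-cancelʳ (extend g (⟦ h₂ ⟧ᴸ ρ)) _ _ (begin
    extend g (⟦ e₁ ⟧ᴸ ρ) +ℚ extend g (⟦ h₂ ⟧ᴸ ρ)   ≡⟨ extend-++ g (⟦ e₁ ⟧ᴸ ρ) (⟦ h₂ ⟧ᴸ ρ) ⟨
    extend g (⟦ e₁ ⊞ h₂ ⟧ᴸ ρ)
      ≡⟨ extend-resp-≋ g (linear-identity (e₁ ⊞ h₂) (e₂ ⊞ h₁) ρ same) ⟩
    extend g (⟦ e₂ ⊞ h₁ ⟧ᴸ ρ)                       ≡⟨ extend-++ g (⟦ e₂ ⟧ᴸ ρ) (⟦ h₁ ⟧ᴸ ρ) ⟩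
    extend g (⟦ e₂ ⟧ᴸ ρ) +ℚ extend g (⟦ h₁ ⟧ᴸ ρ)
      ≡⟨ cong (extend g (⟦ e₂ ⟧ᴸ ρ) +ℚ_) (extend-resp-≋ g h₁≋h₂) ⟩
    extend g (⟦ e₂ ⟧ᴸ ρ) +ℚ extend g (⟦ h₂ ⟧ᴸ ρ)   ∎)
  where open ≡-Reasoning

neg-involutive : ∀ p → neg (neg p) ≋ p
neg-involutive p = linear-identity (⊟ ⊟ var (# 0)) (var (# 0)) (p ∷ []) (λ _ → refl)

infixr 25 x∷_ y∷_
x∷_ y∷_ : Poly → Poly
x∷_ = lmul lx
y∷_ = lmul ly

extend-letter· : ∀ g l q → extend g (mono (l ∷ []) · q) ≡ extend g (lmul l q)
extend-letter· g l q = begin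
  extend g (mono (l ∷ []) · q)           ≡⟨ extend-· g (mono (l ∷ [])) q ⟩
  1ℚ *ℚ extend (λ v → g (l ∷ v)) q +ℚ 0ℚ ≡⟨ ℚ.+-identityʳ _ ⟩
  1ℚ *ℚ extend (λ v → g (l ∷ v)) q       ≡⟨ ℚ.*-identityˡ _ ⟩
  extend (λ v → g (l ∷ v)) q             ≡⟨ extend-lmul g l q ⟨
  extend g (lmul l q)                    ∎
  where open ≡-Reasoning

x·≋x∷ : ∀ q → x · q ≋ x∷ q
x·≋x∷ q = ≋-by-extend λ g → extend-letter· g lx q

y·≋y∷ : ∀ q → y · q ≋ y∷ q
y·≋y∷ q = ≋-by-extend λ g → extend-letter· g ly q

z·≋ : ∀ q → z · q ≋ x∷ q ⊕ y∷ q
z·≋ q = ≋-by-extend λ g → begin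
  extend g (z · q)                                          ≡⟨ extend-· g z q ⟩
  1ℚ *ℚ extend (λ v → g (lx ∷ v)) q +ℚ (1ℚ *ℚ extend (λ v → g (ly ∷ v)) q +ℚ 0ℚ)
    ≡⟨ solve 2 (λ a b → con 1ℚ :* a :+ (con 1ℚ :* b :+ con 0ℚ) := a :+ b) refl
         (extend (λ v → g (lx ∷ v)) q) (extend (λ v → g (ly ∷ v)) q) ⟩
  extend (λ v → g (lx ∷ v)) q +ℚ extend (λ v → g (ly ∷ v)) q
    ≡⟨ cong₂ _+ℚ_ (extend-lmul g lx q) (extend-lmul g ly q) ⟨
  extend g (x∷ q) +ℚ extend g (y∷ q)                       ≡⟨ extend-++ g (x∷ q) (y∷ q) ⟨
  extend g (x∷ q ⊕ y∷ q)                                   ∎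
  where open ≡-Reasoning

-y·≋ : ∀ q → neg y · q ≋ neg (y∷ q)
-y·≋ q = ≋-by-extend λ g → begin
  extend g (neg y · q)                                 ≡⟨ extend-· g (neg y) q ⟩
  ((-ℚ 1ℚ) *ℚ 1ℚ) *ℚ extend (λ v → g (ly ∷ v)) q +ℚ 0ℚ
    ≡⟨ solve 1 (λ a → (con (-ℚ 1ℚ) :* con 1ℚ) :* a :+ con 0ℚ := :- a) refl (extend (λ v → g (ly ∷ v)) q) ⟩
  -ℚ extend (λ v → g (ly ∷ v)) q                           ≡⟨ cong -ℚ_ (extend-lmul g ly q) ⟨
  -ℚ extend g (y∷ q)                                   ≡⟨ extend-neg g (y∷ q) ⟨
  extend g (neg (y∷ q))                                ∎
  where open ≡-Reasoning

extend-·y : ∀ g p → extend g (p · y) ≡ extend (λ u → g (u ++ ly ∷ [])) p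
extend-·y g p = trans (extend-· g p y) (extend-cong p λ u → trans (ℚ.+-identityʳ _) (ℚ.*-identityˡ _))

⊕-cong : ∀ {p p′ q q′} → p ≋ p′ → q ≋ q′ → p ⊕ q ≋ p′ ⊕ q′
⊕-cong {p} {p′} {q} {q′} p≋p′ q≋q′ = ≋-by-extend λ g →
  trans (extend-++ g p q)
        (trans (cong₂ _+ℚ_ (extend-resp-≋ g p≋p′) (extend-resp-≋ g q≋q′)) (sym (extend-++ g p′ q′)))

record Linear (T : Poly → Poly) : Set where
  field
    transpose : (Word → ℚ) → Word → ℚ
    extend-transpose : ∀ g p → extend g (T p) ≡ extend (transpose g) p
open Linear

linear-cong : ∀ {T} → Linear T → ∀ {p q} → p ≋ q → T p ≋ T q
linear-cong L {p} {q} p≋q = ≋-by-extend λ g →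
  trans (extend-transpose L g p) (trans (extend-resp-≋ _ p≋q) (sym (extend-transpose L g q)))

linear-⊕ : ∀ {T} → Linear T → ∀ p q → T (p ⊕ q) ≋ T p ⊕ T q
linear-⊕ {T} L p q = ≋-by-extend λ g → begin
  extend g (T (p ⊕ q))                                   ≡⟨ extend-transpose L g (p ⊕ q) ⟩
  extend (transpose L g) (p ⊕ q)                         ≡⟨ extend-++ _ p q ⟩
  extend (transpose L g) p +ℚ extend (transpose L g) q
    ≡⟨ cong₂ _+ℚ_ (extend-transpose L g p) (extend-transpose L g q) ⟨
  extend g (T p) +ℚ extend g (T q)                       ≡⟨ extend-++ g (T p) (T q) ⟨
  extend g (T p ⊕ T q)                                   ∎
  where open ≡-Reasoning

linear-neg : ∀ {T} → Linear T → ∀ p → T (neg p) ≋ neg (T p)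
linear-neg {T} L p = ≋-by-extend λ g → begin
  extend g (T (neg p))                 ≡⟨ extend-transpose L g (neg p) ⟩
  extend (transpose L g) (neg p)       ≡⟨ extend-neg _ p ⟩
  -ℚ extend (transpose L g) p          ≡⟨ cong -ℚ_ (extend-transpose L g p) ⟨
  -ℚ extend g (T p)                    ≡⟨ extend-neg g (T p) ⟨
  extend g (neg (T p))                 ∎
  where open ≡-Reasoning

linear-⊖ : ∀ {T} → Linear T → ∀ p q → T (p ⊖ q) ≋ T p ⊖ T q
linear-⊖ L p q = ≋-trans (linear-⊕ L p (neg q)) (⊕-cong ≋-refl (linear-neg L q))

∘-linear : ∀ {T U} → Linear T → Linear U → Linear (T ∘′ U)
∘-linear {T} {U} L M = record
  { transpose = λ g → transpose M (transpose L g)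
  ; extend-transpose = λ g p → trans (extend-transpose L g (U p)) (extend-transpose M (transpose L g) p)
  }

neg-linear : Linear neg
neg-linear = record
  { transpose = λ g v → -ℚ g v
  ; extend-transpose = λ g p → trans (extend-neg g p) (sym (extend-neg-pointwise g p))
  }

lmul-linear : ∀ l → Linear (lmul l)
lmul-linear l = record { transpose = λ g v → g (l ∷ v) ; extend-transpose = λ g p → extend-lmul g l p }

·y-linear : Linear (_· y)
·y-linear = record { transpose = λ g u → g (u ++ ly ∷ []) ; extend-transpose = extend-·y }

φ-linear : Linear φ
φ-linear = record { transpose = λ g v → extend g (φW v) ; extend-transpose = extend-φ }

✶-linearˡ : ∀ q → Linear (_✶ q)
✶-linearˡ q = record
  { transpose = λ g u → extend (λ v → extend g (harmW u v)) q
  ; extend-transpose = λ g p → extend-✶ g p q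
  }

✶-linearʳ : ∀ p → Linear (p ✶_)
✶-linearʳ p = record
  { transpose = λ g v → extend (λ u → extend g (harmW u v)) p
  ; extend-transpose = λ g q → trans (extend-✶ g p q) (extend₂-swap _ p q)
  }

neg-cong : ∀ {p q} → p ≋ q → neg p ≋ neg q
neg-cong = linear-cong neg-linear

lmul-cong : ∀ l {p q} → p ≋ q → lmul l p ≋ lmul l q
lmul-cong l = linear-cong (lmul-linear l)

·y-cong : ∀ {p q} → p ≋ q → p · y ≋ q · y
·y-cong = linear-cong ·y-linear

φ-cong : ∀ {p q} → p ≋ q → φ p ≋ φ q
φ-cong = linear-cong φ-linear

lmul-⊕ : ∀ l p q → lmul l (p ⊕ q) ≋ lmul l p ⊕ lmul l q
lmul-⊕ l p q = ≡⇒≋ (map-++ _ p q)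

·y-lmul : ∀ l p → lmul l p · y ≋ lmul l (p · y)
·y-lmul l p = ≋-by-extend λ g →
  trans (extend-·y g (lmul l p)) (trans (extend-lmul _ l p)
  (trans (sym (extend-·y _ p)) (sym (extend-lmul g l (p · y)))))

-- The involution φ

φ-lmul : ∀ l p → φ (lmul l p) ≋ φL l · φ p
φ-lmul l p = ≋-by-extend λ g → let G = λ a b → g (a ++ b) in begin
  extend g (φ (lmul l p))                                      ≡⟨ extend-φ g (lmul l p) ⟩
  extend (λ v → extend g (φW v)) (lmul l p)                    ≡⟨ extend-lmul _ l p ⟩
  extend (λ v → extend g (φL l · φW v)) p
    ≡⟨ extend-cong p (λ v → extend-· g (φL l) (φW v)) ⟩
  extend₂ (λ v a → extend (G a) (φW v)) p (φL l)               ≡⟨ extend₂-swap _ p (φL l) ⟩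
  extend (λ a → extend (λ v → extend (G a) (φW v)) p) (φL l)
    ≡⟨ extend-cong (φL l) (λ a → extend-φ (G a) p) ⟨
  extend₂ G (φL l) (φ p)                                       ≡⟨ extend-· g (φL l) (φ p) ⟨
  extend g (φL l · φ p)                                        ∎
  where open ≡-Reasoning

φ-x∷ : ∀ p → φ (x∷ p) ≋ x∷ φ p ⊕ y∷ φ p
φ-x∷ p = ≋-trans (φ-lmul lx p) (z·≋ (φ p))

φ-y∷ : ∀ p → φ (y∷ p) ≋ neg (y∷ φ p)
φ-y∷ p = ≋-trans (φ-lmul ly p) (-y·≋ (φ p))

y∷φ≋-φy∷ : ∀ p → y∷ φ p ≋ neg (φ (y∷ p))
y∷φ≋-φy∷ p = ≋-trans (≋-sym (neg-involutive (y∷ φ p))) (neg-cong (≋-sym (φ-y∷ p)))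

φ-y∷-of-neg : ∀ q {r} → φ q ≋ neg r → φ (y∷ q) ≋ y∷ r
φ-y∷-of-neg q {r} φq≋-r = begin
  φ (y∷ q)           ≈⟨ φ-y∷ q ⟩
  neg (y∷ φ q)       ≈⟨ neg-cong (lmul-cong ly φq≋-r) ⟩
  neg (y∷ neg r)     ≈⟨ neg-cong (linear-neg (lmul-linear ly) r) ⟩
  neg (neg (y∷ r))   ≈⟨ neg-involutive (y∷ r) ⟩
  y∷ r               ∎
  where open ≋-Reasoning

φ-mono : ∀ v → φ (mono v) ≋ φW v
φ-mono v = ≋-by-extend λ g →
  trans (extend-++ g (scale 1ℚ (φW v)) []) (trans (ℚ.+-identityʳ _)
  (trans (extend-scale g 1ℚ (φW v)) (ℚ.*-identityˡ _)))

φ-x∷⊕φ-y∷ : ∀ q → φ (x∷ q) ⊕ φ (y∷ q) ≋ x∷ φ q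
φ-x∷⊕φ-y∷ q = begin
  φ (x∷ q) ⊕ φ (y∷ q)              ≈⟨ ⊕-cong (φ-x∷ q) (φ-y∷ q) ⟩
  x∷ φ q ⊕ y∷ φ q ⊖ y∷ φ q         ≈⟨ linear-identity (var (# 0) ⊞ var (# 1) ⊟ var (# 1)) (var (# 0))
                                        (x∷ φ q ∷ y∷ φ q ∷ []) (λ _ → refl) ⟩
  x∷ φ q                           ∎
  where open ≋-Reasoning

φ-z· : ∀ q → φ (z · q) ≋ x∷ φ q
φ-z· q = ≋-trans (φ-cong (z·≋ q)) (≋-trans (linear-⊕ φ-linear (x∷ q) (y∷ q)) (φ-x∷⊕φ-y∷ q))

φ-[-y]· : ∀ q → φ (neg y · q) ≋ y∷ φ q
φ-[-y]· q = begin
  φ (neg y · q)                    ≈⟨ φ-cong (-y·≋ q) ⟩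
  φ (neg (y∷ q))                   ≈⟨ linear-neg φ-linear (y∷ q) ⟩
  neg (φ (y∷ q))                   ≈⟨ neg-cong (φ-y∷ q) ⟩
  neg (neg (y∷ φ q))               ≈⟨ neg-involutive (y∷ φ q) ⟩
  y∷ φ q                           ∎
  where open ≋-Reasoning

φ-φW : ∀ v → φ (φW v) ≋ mono v
φ-φW [] = φ-mono []
φ-φW (lx ∷ v) = ≋-trans (φ-z· (φW v)) (lmul-cong lx (φ-φW v))
φ-φW (ly ∷ v) = ≋-trans (φ-[-y]· (φW v)) (lmul-cong ly (φ-φW v))

φ-involutive : ∀ p → φ (φ p) ≋ p
φ-involutive p = ≋-by-extend λ g → begin
  extend g (φ (φ p))                                         ≡⟨ extend-φ g (φ p) ⟩
  extend (λ v → extend g (φW v)) (φ p)                       ≡⟨ extend-φ _ p ⟩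
  extend (λ w → extend (λ v → extend g (φW v)) (φW w)) p     ≡⟨ extend-cong p (λ w → extend-φ g (φW w)) ⟨
  extend (λ w → extend g (φ (φW w))) p
    ≡⟨ extend-cong p (λ w → extend-resp-≋ g (φ-φW w)) ⟩
  extend (λ w → extend g (mono w)) p                         ≡⟨ extend-cong p (extend-mono g) ⟩
  extend g p                                                 ∎
  where open ≡-Reasoning

-- The harmonic product

✶-cong : ∀ {p p′ q q′} → p ≋ p′ → q ≋ q′ → p ✶ q ≋ p′ ✶ q′
✶-cong {p} {p′} {q} {q′} p≋p′ q≋q′ = ≋-trans (linear-cong (✶-linearˡ q) p≋p′) (linear-cong (✶-linearʳ p′) q≋q′)

✶-neg-neg : ∀ p q → neg p ✶ neg q ≋ p ✶ q
✶-neg-neg p q = ≋-trans (linear-neg (✶-linearˡ (neg q)) p)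
                (≋-trans (neg-cong (linear-neg (✶-linearʳ p) q)) (neg-involutive (p ✶ q)))

✶-identityˡ : ∀ q → mono [] ✶ q ≋ q
✶-identityˡ q = ≋-by-extend λ g → begin
  extend g (mono [] ✶ q)                              ≡⟨ extend-✶ g (mono []) q ⟩
  extend₂ (λ u v → extend g (harmW u v)) (mono []) q
    ≡⟨ extend-mono (λ u → extend (λ v → extend g (harmW u v)) q) [] ⟩
  extend (λ v → extend g (mono v)) q                  ≡⟨ extend-cong q (extend-mono g) ⟩
  extend g q                                          ∎
  where open ≡-Reasoning

harmW-x∷ʳ : ∀ u v → harmW u (lx ∷ v) ≋ x∷ harmW u v
harmW-x∷ʳ [] v = ≋-refl
harmW-x∷ʳ (lx ∷ u) v = lmul-cong lx (harmW-x∷ʳ u v)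
harmW-x∷ʳ (ly ∷ u) v = ≋-refl

extend-linear-✶ : ∀ {T} → Linear T → ∀ g p q →
  extend g (T (p ✶ q)) ≡ extend₂ (λ u v → extend g (T (harmW u v))) p q
extend-linear-✶ L g p q =
  trans (extend-transpose L g (p ✶ q))
        (trans (extend-✶ _ p q) (extend₂-cong p q (λ u v → sym (extend-transpose L g (harmW u v)))))

✶-x∷ʳ : ∀ p q → p ✶ x∷ q ≋ x∷ (p ✶ q)
✶-x∷ʳ p q = ≋-by-extend λ g → begin
  extend g (p ✶ x∷ q)                                  ≡⟨ extend-✶ g p (x∷ q) ⟩
  extend₂ (λ u v → extend g (harmW u v)) p (x∷ q)      ≡⟨ extend₂-lmulʳ _ lx p q ⟩
  extend₂ (λ u v → extend g (harmW u (lx ∷ v))) p q    ≡⟨ extend₂-cong p q (λ u v → extend-resp-≋ g (harmW-x∷ʳ u v)) ⟩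
  extend₂ (λ u v → extend g (x∷ harmW u v)) p q        ≡⟨ extend-linear-✶ (lmul-linear lx) g p q ⟨
  extend g (x∷ (p ✶ q))                                ∎
  where open ≡-Reasoning

✶-y∷y∷ : ∀ p q → y∷ p ✶ y∷ q ≋ y∷ (p ✶ y∷ q) ⊕ y∷ (y∷ p ✶ q) ⊕ y∷ x∷ (p ✶ q)
✶-y∷y∷ p q = ≋-by-extend same-forms
  where
  extend-⊕₃ : ∀ g a b c → extend g (a ⊕ b ⊕ c) ≡ extend g a +ℚ extend g b +ℚ extend g c
  extend-⊕₃ g a b c = trans (extend-++ g (a ⊕ b) c) (cong (_+ℚ extend g c) (extend-++ g a b))
  same-forms : ∀ g → extend g (y∷ p ✶ y∷ q) ≡ extend g (y∷ (p ✶ y∷ q) ⊕ y∷ (y∷ p ✶ q) ⊕ y∷ x∷ (p ✶ q))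
  same-forms g = begin
    extend g (y∷ p ✶ y∷ q)
      ≡⟨ trans (extend-✶ g (y∷ p) (y∷ q)) (trans (extend₂-lmulˡ _ ly p (y∷ q)) (extend₂-lmulʳ _ ly p q)) ⟩
    extend₂ (λ u v → extend g (harmW (ly ∷ u) (ly ∷ v))) p q
      ≡⟨ extend₂-cong p q (λ u v → extend-⊕₃ g (y∷ harmW u (ly ∷ v)) (y∷ harmW (ly ∷ u) v) (y∷ x∷ harmW u v)) ⟩
    extend₂ (λ u v → T₁ u v +ℚ T₂ u v +ℚ T₃ u v) p q
      ≡⟨ trans (extend₂-+ _ T₃ p q) (cong (_+ℚ extend₂ T₃ p q) (extend₂-+ T₁ T₂ p q)) ⟩
    extend₂ T₁ p q +ℚ extend₂ T₂ p q +ℚ extend₂ T₃ p q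
      ≡⟨ cong₂ _+ℚ_ (cong₂ _+ℚ_ T₁-sum T₂-sum) (extend-linear-✶ y∷x∷-linear g p q) ⟨
    extend g (y∷ (p ✶ y∷ q)) +ℚ extend g (y∷ (y∷ p ✶ q)) +ℚ extend g (y∷ x∷ (p ✶ q))
      ≡⟨ extend-⊕₃ g (y∷ (p ✶ y∷ q)) (y∷ (y∷ p ✶ q)) (y∷ x∷ (p ✶ q)) ⟨
    extend g (y∷ (p ✶ y∷ q) ⊕ y∷ (y∷ p ✶ q) ⊕ y∷ x∷ (p ✶ q))
      ∎
    where
    open ≡-Reasoning
    T₁ T₂ T₃ : Word → Word → ℚ
    T₁ u v = extend g (y∷ harmW u (ly ∷ v))
    T₂ u v = extend g (y∷ harmW (ly ∷ u) v)
    T₃ u v = extend g (y∷ x∷ harmW u v)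
    y∷x∷-linear : Linear (y∷_ ∘′ x∷_)
    y∷x∷-linear = ∘-linear (lmul-linear ly) (lmul-linear lx)
    T₁-sum : extend g (y∷ (p ✶ y∷ q)) ≡ extend₂ T₁ p q
    T₁-sum = trans (extend-linear-✶ (lmul-linear ly) g p (y∷ q)) (extend₂-lmulʳ _ ly p q)
    T₂-sum : extend g (y∷ (y∷ p ✶ q)) ≡ extend₂ T₂ p q
    T₂-sum = trans (extend-linear-✶ (lmul-linear ly) g (y∷ p) q) (extend₂-lmulˡ _ ly p q)

-- The product ◇

◇-congʳ : ∀ p {w w′} → w ≋ w′ → p ◇ w ≋ p ◇ w′
◇-congʳ p w≋w′ = φ-cong (✶-cong (≋-refl {φ p}) (φ-cong w≋w′))

◇-identityˡ : ∀ w → mono [] ◇ w ≋ w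
◇-identityˡ w = begin
  φ (φ (mono []) ✶ φ w)     ≈⟨ φ-cong (✶-cong (φ-mono []) (≋-refl {φ w})) ⟩
  φ (mono [] ✶ φ w)         ≈⟨ φ-cong (✶-identityˡ (φ w)) ⟩
  φ (φ w)                   ≈⟨ φ-involutive w ⟩
  w                         ∎
  where open ≋-Reasoning

-- φ turns left multiplication by z into left multiplication by x, which passes through the harmonic
-- product on the right factor.
◇-z∷ʳ : ∀ p w → p ◇ x∷ w ⊕ p ◇ y∷ w ≋ x∷ (p ◇ w) ⊕ y∷ (p ◇ w)
◇-z∷ʳ p w = begin
  φ (φ p ✶ φ (x∷ w)) ⊕ φ (φ p ✶ φ (y∷ w))   ≈⟨ linear-⊕ φ-linear (φ p ✶ φ (x∷ w)) (φ p ✶ φ (y∷ w)) ⟨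
  φ (φ p ✶ φ (x∷ w) ⊕ φ p ✶ φ (y∷ w))       ≈⟨ φ-cong (linear-⊕ (✶-linearʳ (φ p)) (φ (x∷ w)) (φ (y∷ w))) ⟨
  φ (φ p ✶ (φ (x∷ w) ⊕ φ (y∷ w)))           ≈⟨ φ-cong (✶-cong (≋-refl {φ p}) (φ-x∷⊕φ-y∷ w)) ⟩
  φ (φ p ✶ x∷ φ w)                          ≈⟨ φ-cong (✶-x∷ʳ (φ p) (φ w)) ⟩
  φ (x∷ (φ p ✶ φ w))                        ≈⟨ φ-x∷ (φ p ✶ φ w) ⟩
  x∷ (p ◇ w) ⊕ y∷ (p ◇ w)                   ∎
  where open ≋-Reasoning

◇-y∷y∷-expand : ∀ p w → y∷ p ◇ y∷ w ≋ y∷ (p ◇ y∷ w) ⊕ y∷ (y∷ p ◇ w) ⊖ y∷ (x∷ (p ◇ w) ⊕ y∷ (p ◇ w))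
◇-y∷y∷-expand p w = begin
  φ (φ (y∷ p) ✶ φ (y∷ w))                                     ≈⟨ φ-cong (✶-cong (φ-y∷ p) (φ-y∷ w)) ⟩
  φ (neg (y∷ A) ✶ neg (y∷ B))                                 ≈⟨ φ-cong (✶-neg-neg (y∷ A) (y∷ B)) ⟩
  φ (y∷ A ✶ y∷ B)                                             ≈⟨ φ-cong (✶-y∷y∷ A B) ⟩
  φ (y∷ (A ✶ y∷ B) ⊕ y∷ (y∷ A ✶ B) ⊕ y∷ x∷ (A ✶ B))          ≈⟨ φ-⊕₃ ⟩
  φ (y∷ (A ✶ y∷ B)) ⊕ φ (y∷ (y∷ A ✶ B)) ⊕ φ (y∷ x∷ (A ✶ B))
    ≈⟨ ⊕-cong (⊕-cong (φ-y∷-of-neg (A ✶ y∷ B) φ[A✶y∷B]) (φ-y∷-of-neg (y∷ A ✶ B) φ[y∷A✶B]))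
              (≋-trans (φ-y∷ (x∷ (A ✶ B))) (neg-cong (lmul-cong ly (φ-x∷ (A ✶ B))))) ⟩
  y∷ (p ◇ y∷ w) ⊕ y∷ (y∷ p ◇ w) ⊖ y∷ (x∷ (p ◇ w) ⊕ y∷ (p ◇ w))     ∎
  where
  open ≋-Reasoning
  A = φ p
  B = φ w
  φ-⊕₃ : φ (y∷ (A ✶ y∷ B) ⊕ y∷ (y∷ A ✶ B) ⊕ y∷ x∷ (A ✶ B))
       ≋ φ (y∷ (A ✶ y∷ B)) ⊕ φ (y∷ (y∷ A ✶ B)) ⊕ φ (y∷ x∷ (A ✶ B))
  φ-⊕₃ = ≋-trans (linear-⊕ φ-linear (y∷ (A ✶ y∷ B) ⊕ y∷ (y∷ A ✶ B)) (y∷ x∷ (A ✶ B)))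
                 (⊕-cong (linear-⊕ φ-linear (y∷ (A ✶ y∷ B)) (y∷ (y∷ A ✶ B))) (≋-refl {φ (y∷ x∷ (A ✶ B))}))
  φ[A✶y∷B] : φ (A ✶ y∷ B) ≋ neg (p ◇ y∷ w)
  φ[A✶y∷B] = ≋-trans (φ-cong (≋-trans (✶-cong (≋-refl {A}) (y∷φ≋-φy∷ w)) (linear-neg (✶-linearʳ A) (φ (y∷ w)))))
                     (linear-neg φ-linear (A ✶ φ (y∷ w)))
  φ[y∷A✶B] : φ (y∷ A ✶ B) ≋ neg (y∷ p ◇ w)
  φ[y∷A✶B] = ≋-trans (φ-cong (≋-trans (✶-cong (y∷φ≋-φy∷ p) (≋-refl {B})) (linear-neg (✶-linearˡ B) (φ (y∷ p)))))
                     (linear-neg φ-linear (φ (y∷ p) ✶ B))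

◇-y∷y∷ : ∀ p w → y∷ p ◇ y∷ w ≋ y∷ (y∷ p ◇ w) ⊖ y∷ (p ◇ x∷ w)
◇-y∷y∷ p w = begin
  y∷ p ◇ y∷ w                                                  ≈⟨ ◇-y∷y∷-expand p w ⟩
  y∷ (p ◇ y∷ w) ⊕ y∷ (y∷ p ◇ w) ⊖ y∷ (x∷ (p ◇ w) ⊕ y∷ (p ◇ w))  ≈⟨ ⊕-cong ≋-refl (neg-cong y∷[◇-z∷ʳ]) ⟨
  y∷ (p ◇ y∷ w) ⊕ y∷ (y∷ p ◇ w) ⊖ (y∷ (p ◇ x∷ w) ⊕ y∷ (p ◇ y∷ w))
    ≈⟨ linear-identity (var (# 0) ⊞ var (# 1) ⊟ (var (# 2) ⊞ var (# 0))) (var (# 1) ⊟ var (# 2))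
                       (y∷ (p ◇ y∷ w) ∷ y∷ (y∷ p ◇ w) ∷ y∷ (p ◇ x∷ w) ∷ []) (λ _ → refl) ⟩
  y∷ (y∷ p ◇ w) ⊖ y∷ (p ◇ x∷ w)                                ∎
  where
  open ≋-Reasoning
  y∷[◇-z∷ʳ] : y∷ (p ◇ x∷ w) ⊕ y∷ (p ◇ y∷ w) ≋ y∷ (x∷ (p ◇ w) ⊕ y∷ (p ◇ w))
  y∷[◇-z∷ʳ] = ≋-trans (≋-sym (lmul-⊕ ly (p ◇ x∷ w) (p ◇ y∷ w))) (lmul-cong ly (◇-z∷ʳ p w))

-- Zero for n < 0, which makes f≋y^◇ below hold uniformly in n.
infixr 20 y^_◇_
y^_◇_ : ℤ → Poly → Poly
y^ + n ◇ w = yPow n ◇ w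
y^ -[1+ _ ] ◇ w = []

y^◇-congʳ : ∀ n {w w′} → w ≋ w′ → y^ n ◇ w ≋ y^ n ◇ w′
y^◇-congʳ (+ n) = ◇-congʳ (yPow n)
y^◇-congʳ -[1+ _ ] _ = ≋-refl

y^◇-z∷ʳ : ∀ n w → y^ n ◇ x∷ w ⊕ y^ n ◇ y∷ w ≋ x∷ (y^ n ◇ w) ⊕ y∷ (y^ n ◇ w)
y^◇-z∷ʳ (+ n) = ◇-z∷ʳ (yPow n)
y^◇-z∷ʳ -[1+ _ ] _ = ≋-refl

y^◇-y∷ʳ : ∀ n w → y^ n ◇ y∷ w ≋ y∷ (y^ n ◇ w) ⊖ y∷ (y^ (n - 1ℤ) ◇ x∷ w)
y^◇-y∷ʳ (+ zero) w =
  ≋-trans (◇-identityˡ (y∷ w)) (≋-trans (lmul-cong ly (≋-sym (◇-identityˡ w))) (≋-sym (⊕-identityʳ _)))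
y^◇-y∷ʳ (+ suc n) w = ◇-y∷y∷ (yPow n) w
y^◇-y∷ʳ -[1+ _ ] w = ≋-refl

-- The maps f_n

f≋y^◇ : ∀ n w → f n w ≋ y^ n ◇ w ⊖ (y^ (n - 1ℤ) ◇ w) · y
f≋y^◇ (+ zero) w = ≋-sym (≋-trans (⊕-identityʳ (mono [] ◇ w)) (◇-identityˡ w))
f≋y^◇ (+ suc n) w = ≋-refl
f≋y^◇ -[1+ _ ] w = ≋-refl

f-cong : ∀ n {w w′} → w ≋ w′ → f n w ≋ f n w′
f-cong n {w} {w′} w≋w′ = begin
  f n w                                         ≈⟨ f≋y^◇ n w ⟩
  y^ n ◇ w ⊖ (y^ (n - 1ℤ) ◇ w) · y
    ≈⟨ ⊕-cong (y^◇-congʳ n w≋w′) (neg-cong (·y-cong (y^◇-congʳ (n - 1ℤ) w≋w′))) ⟩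
  y^ n ◇ w′ ⊖ (y^ (n - 1ℤ) ◇ w′) · y            ≈⟨ f≋y^◇ n w′ ⟨
  f n w′                                        ∎
  where open ≋-Reasoning

f-y∷ : ∀ n w → f n (y∷ w) ≋ y∷ f n w ⊖ y∷ f (n - 1ℤ) (x∷ w)
f-y∷ n w = begin
  f n (y∷ w)
    ≈⟨ f≋y^◇ n (y∷ w) ⟩
  y^ n ◇ y∷ w ⊖ (y^ n-1 ◇ y∷ w) · y
    ≈⟨ ⊕-cong (y^◇-y∷ʳ n w) (neg-cong (≋-trans (·y-cong (y^◇-y∷ʳ n-1 w)) (linear-⊖ ·y-linear (y∷ C) (y∷ E)))) ⟩
  y∷ A ⊖ y∷ B ⊖ (y∷ C · y ⊖ y∷ E · y)
    ≈⟨ ⊕-cong (≋-refl {y∷ A ⊖ y∷ B}) (neg-cong (⊕-cong (·y-lmul ly C) (neg-cong (·y-lmul ly E)))) ⟩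
  y∷ A ⊖ y∷ B ⊖ (y∷ (C · y) ⊖ y∷ (E · y))
    ≈⟨ linear-identity (var (# 0) ⊟ var (# 1) ⊟ (var (# 2) ⊟ var (# 3)))
                       (var (# 0) ⊟ var (# 2) ⊟ (var (# 1) ⊟ var (# 3)))
                       (y∷ A ∷ y∷ B ∷ y∷ (C · y) ∷ y∷ (E · y) ∷ []) (λ _ → refl) ⟩
  y∷ A ⊖ y∷ (C · y) ⊖ (y∷ B ⊖ y∷ (E · y))
    ≈⟨ ⊕-cong (linear-⊖ (lmul-linear ly) A (C · y)) (neg-cong (linear-⊖ (lmul-linear ly) B (E · y))) ⟨
  y∷ (A ⊖ C · y) ⊖ y∷ (B ⊖ E · y)
    ≈⟨ ⊕-cong (lmul-cong ly (f≋y^◇ n w)) (neg-cong (lmul-cong ly (f≋y^◇ n-1 (x∷ w)))) ⟨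
  y∷ f n w ⊖ y∷ f n-1 (x∷ w)
    ∎
  where
  open ≋-Reasoning
  n-1 = n - 1ℤ
  A = y^ n ◇ w
  B = y^ n-1 ◇ x∷ w
  C = y^ n-1 ◇ w
  E = y^ (n-1 - 1ℤ) ◇ x∷ w

f-z∷ : ∀ n w → f n (x∷ w) ⊕ f n (y∷ w) ≋ x∷ f n w ⊕ y∷ f n w
f-z∷ n w = begin
  f n (x∷ w) ⊕ f n (y∷ w)
    ≈⟨ ⊕-cong (f≋y^◇ n (x∷ w)) (f≋y^◇ n (y∷ w)) ⟩
  (y^ n ◇ x∷ w ⊖ (y^ n-1 ◇ x∷ w) · y) ⊕ (y^ n ◇ y∷ w ⊖ (y^ n-1 ◇ y∷ w) · y)
    ≈⟨ linear-identity-using ((var (# 0) ⊟ var (# 2)) ⊞ (var (# 1) ⊟ var (# 3)))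
                             ((var (# 4) ⊟ var (# 6)) ⊞ (var (# 5) ⊟ var (# 7)))
                             ((var (# 0) ⊞ var (# 1)) ⊞ (var (# 6) ⊞ var (# 7)))
                             ((var (# 4) ⊞ var (# 5)) ⊞ (var (# 2) ⊞ var (# 3)))
                             (y^ n ◇ x∷ w ∷ y^ n ◇ y∷ w ∷ (y^ n-1 ◇ x∷ w) · y ∷ (y^ n-1 ◇ y∷ w) · y ∷
                              x∷ P ∷ y∷ P ∷ x∷ (Q · y) ∷ y∷ (Q · y) ∷ [])
                             (⊕-cong (y^◇-z∷ʳ n w) (≋-sym z∷ʳ·y)) (λ _ → refl) ⟩
  (x∷ P ⊖ x∷ (Q · y)) ⊕ (y∷ P ⊖ y∷ (Q · y))
    ≈⟨ ⊕-cong (linear-⊖ (lmul-linear lx) P (Q · y)) (linear-⊖ (lmul-linear ly) P (Q · y)) ⟨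
  x∷ (P ⊖ Q · y) ⊕ y∷ (P ⊖ Q · y)
    ≈⟨ ⊕-cong (lmul-cong lx (f≋y^◇ n w)) (lmul-cong ly (f≋y^◇ n w)) ⟨
  x∷ f n w ⊕ y∷ f n w
    ∎
  where
  open ≋-Reasoning
  n-1 = n - 1ℤ
  P = y^ n ◇ w
  Q = y^ n-1 ◇ w
  z∷ʳ·y : (y^ n-1 ◇ x∷ w) · y ⊕ (y^ n-1 ◇ y∷ w) · y ≋ x∷ (Q · y) ⊕ y∷ (Q · y)
  z∷ʳ·y = begin
    (y^ n-1 ◇ x∷ w) · y ⊕ (y^ n-1 ◇ y∷ w) · y  ≈⟨ linear-⊕ ·y-linear (y^ n-1 ◇ x∷ w) (y^ n-1 ◇ y∷ w) ⟨
    (y^ n-1 ◇ x∷ w ⊕ y^ n-1 ◇ y∷ w) · y        ≈⟨ ·y-cong (y^◇-z∷ʳ n-1 w) ⟩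
    (x∷ Q ⊕ y∷ Q) · y                          ≈⟨ linear-⊕ ·y-linear (x∷ Q) (y∷ Q) ⟩
    x∷ Q · y ⊕ y∷ Q · y                        ≈⟨ ⊕-cong (·y-lmul lx Q) (·y-lmul ly Q) ⟩
    x∷ (Q · y) ⊕ y∷ (Q · y)                    ∎

f-x∷ : ∀ n w → f n (x∷ w) ≋ x∷ f n w ⊕ y∷ f (n - 1ℤ) (x∷ w)
f-x∷ n w =
  linear-identity-using (var (# 0)) (var (# 2) ⊞ var (# 4))
    ((var (# 0) ⊞ var (# 1)) ⊞ (var (# 3) ⊟ var (# 4))) ((var (# 2) ⊞ var (# 3)) ⊞ var (# 1))
    (f n (x∷ w) ∷ f n (y∷ w) ∷ x∷ f n w ∷ y∷ f n w ∷ y∷ f (n - 1ℤ) (x∷ w) ∷ [])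
    (⊕-cong (f-z∷ n w) (≋-sym (f-y∷ n w))) (λ _ → refl)

lemma5p1 : (n : ℤ) (w : Poly) →
    (f n (x · w) ≈ (x · f n w) ⊕ (y · f (n - 1ℤ) (x · w)))
    × (f n (y · w) ≈ (y · f n w) ⊖ (y · f (n - 1ℤ) (x · w)))
lemma5p1 n w = coeff-≡ (begin
    f n (x · w)                                ≈⟨ f-cong n (x·≋x∷ w) ⟩
    f n (x∷ w)                                 ≈⟨ f-x∷ n w ⟩
    x∷ f n w ⊕ y∷ f (n - 1ℤ) (x∷ w)            ≈⟨ ⊕-cong (x·≋x∷ (f n w)) y·f[x·w] ⟨
    x · f n w ⊕ y · f (n - 1ℤ) (x · w)         ∎)
  , coeff-≡ (begin
    f n (y · w)                                ≈⟨ f-cong n (y·≋y∷ w) ⟩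
    f n (y∷ w)                                 ≈⟨ f-y∷ n w ⟩
    y∷ f n w ⊖ y∷ f (n - 1ℤ) (x∷ w)            ≈⟨ ⊕-cong (y·≋y∷ (f n w)) (neg-cong y·f[x·w]) ⟨
    y · f n w ⊖ y · f (n - 1ℤ) (x · w)         ∎)
  where
  open ≋-Reasoning
  y·f[x·w] : y · f (n - 1ℤ) (x · w) ≋ y∷ f (n - 1ℤ) (x∷ w)
  y·f[x·w] = ≋-trans (y·≋y∷ _) (lmul-cong ly (f-cong (n - 1ℤ) (x·≋x∷ w)))
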